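{- For every $n\geq 2$ and $c\geq 1$, $|UD_n((1,1,c))|=n(n-1)(n^c-2^c)$.
   Context: Let $X$ be an alphabet with $n$ letters. A code over $X$ is a finite sequence $C=(v_1,\ldots,v_m)$ of words over $X$ such that every word $w$ over $X$ has at most one factorization into code-words: if $w=v_{i_1}\cdots v_{i_l}=v_{j_1}\cdots v_{j_{l'}}$ with $l,l'\geq 1$, then $l=l'$ and $i_t=j_t$ for all $t$. For a finite sequence $L=(a_1,\ldots,a_m)$ of natural numbers, $UD_n(L)$ is the set of codes $(v_1,\ldots,v_m)$ over $X$ with $|v_i|=a_i$ for all $i$. -}

module Defs where

open import Data.Nat using (ℕ)
open import Data.Fin using (Fin)
open import Data.List using (List; []; concat; map; length)
open import Data.Vec using (Vec; lookup; toList)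
open import Data.List.Relation.Unary.Unique.Propositional using (Unique)
open import Data.List.Membership.Propositional using (_∈_)
open import Data.List.Relation.Binary.Pointwise using (Pointwise)
open import Data.Product using (Σ; _×_)
open import Relation.Binary.PropositionalEquality using (_≡_; _≢_)

Word : ℕ → Set
Word n = List (Fin n)

WordSeq : ℕ → ℕ → Set
WordSeq n m = Vec (Word n) m

factor : ∀ {n m} → WordSeq n m → List (Fin m) → Word n
factor C is = concat (map (lookup C) is)

IsCode : ∀ {n m} → WordSeq n m → Set
IsCode {n} {m} C =
  (is js : List (Fin m)) → is ≢ [] → js ≢ [] →
  factor C is ≡ factor C js → is ≡ js

UD : (n : ℕ) {m : ℕ} → Vec ℕ m → WordSeq n m → Set
UD n L C = Pointwise (λ v a → length v ≡ a) (toList C) (toList L) × IsCode C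

HasSize : {A : Set} → (A → Set) → ℕ → Set
HasSize {A} P k =
  Σ (List A) λ xs → Unique xs × length xs ≡ k ×
    ((x : A) → x ∈ xs → P x) × ((x : A) → P x → x ∈ xs)

-- A triple (v₁, v₂, v₃) with |v₁| = |v₂| = 1 is a code exactly when v₁ = a and v₂ = b
-- are distinct letters and v₃ = w is not a word over {a, b}: otherwise w is a second
-- factorisation over (a, b), or a = b already is one. Conversely, let p be the position
-- of the first letter of w outside {a, b}. A factorisation starting with w leaves {a, b}
-- at position exactly p, one starting with a letter only strictly later, so decoding is
-- deterministic. Hence the codes are counted by the n (n − 1) ordered pairs a ≠ b times
-- the n^c − 2^c words of length c not over {a, b}.
module Submission where

open import Defs
open import Data.Nat using (ℕ; zero; suc; _≤_; _*_; _+_; _∸_; _^_; _≟_)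
open import Data.Nat.Properties using (m+n∸m≡n; m≤n⇒m≤1+n; ≤-reflexive; 1+n≰n)
open import Data.Fin using (Fin; zero; suc)
import Data.Fin as Fin
open import Data.List using (List; []; _∷_; _++_; length; map; filter; allFin)
open import Data.List.Properties
  using (length-map; length-++; length-tabulate; ++-cancelˡ; ++-identityʳ; ∷-injectiveˡ)
open import Data.List.Membership.Propositional using (_∈_)
open import Data.List.Membership.Propositional.Properties
  using (∈-map⁺; ∈-map⁻; ∈-++⁺ˡ; ∈-++⁺ʳ; ∈-++⁻; ∈-filter⁺; ∈-filter⁻; ∈-allFin)
open import Data.List.Membership.Propositional.Properties.WithK using (unique∧set⇒bag)
open import Data.List.Relation.Binary.BagAndSetEquality using (∼bag⇒↭)
open import Data.List.Relation.Binary.Permutation.Propositional.Properties using (↭-length)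
open import Data.List.Relation.Binary.Pointwise using (_∷_; [])
open import Data.List.Relation.Unary.All as All using (All; _∷_; []; all?)
open import Data.List.Relation.Unary.Any using (here; there)
open import Data.List.Relation.Unary.Unique.Propositional using (Unique; _∷_; [])
open import Data.List.Relation.Unary.Unique.Propositional.Properties using (map⁺; ++⁺; filter⁺; allFin⁺)
open import Data.Vec using (_∷_; []; lookup)
open import Data.Product using (_×_; _,_; proj₁; proj₂; ∃-syntax; uncurry; map₁)
open import Data.Sum using (_⊎_; inj₁; inj₂; [_,_])
import Data.Sum as Sum
open import Data.Unit using (⊤; tt)
open import Data.Empty using (⊥-elim)
open import Function using (_∘_; id)
open import Function.Bundles using (mk⇔)
open import Relation.Nullary using (¬_; yes; no; _×-dec_; _⊎-dec_)
open import Relation.Nullary.Decidable using (toSum)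
open import Relation.Unary using (Decidable)
open import Relation.Unary.Properties using (∁?)
open import Relation.Binary.PropositionalEquality using (_≡_; _≢_; refl; sym; trans; cong; subst)

private
  variable
    A B : Set
    P Q : A → Set
    k j n c : ℕ

HasSize-unique : HasSize P k → HasSize P j → k ≡ j
HasSize-unique (xs , u , refl , sound , complete) (ys , v , refl , sound′ , complete′) =
  ↭-length (∼bag⇒↭ (unique∧set⇒bag u v (mk⇔ (λ x∈xs → complete′ _ (sound _ x∈xs))
                                              (λ x∈ys → complete _ (sound′ _ x∈ys)))))

HasSize-⇔ : (∀ {x} → P x → Q x) → (∀ {x} → Q x → P x) → HasSize P k → HasSize Q k
HasSize-⇔ P⇒Q Q⇒P (xs , u , len , sound , complete) =
  xs , u , len , (λ x x∈ → P⇒Q (sound x x∈)) , (λ x qx → complete x (Q⇒P qx))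

HasSize-map : (f : A → B) → (∀ {x y} → f x ≡ f y → x ≡ y) →
              (∀ {x} → P x → Q (f x)) → (∀ {y} → Q y → ∃[ x ] P x × f x ≡ y) →
              HasSize P k → HasSize Q k
HasSize-map {P = P} {Q = Q} f f-injective P⇒Q Q⇒P (xs , u , len , sound , complete) =
  map f xs , map⁺ f-injective u , trans (length-map f xs) len , sound′ , complete′
  where
  sound′ : ∀ y → y ∈ map f xs → Q y
  sound′ y y∈ with x , x∈ , refl ← ∈-map⁻ f y∈ = P⇒Q (sound x x∈)

  complete′ : ∀ y → Q y → y ∈ map f xs
  complete′ y qy with x , px , refl ← Q⇒P qy = ∈-map⁺ f (complete x px)

HasSize-⊎ : (∀ {x} → P x → ¬ Q x) → HasSize P k → HasSize Q j → HasSize (λ x → P x ⊎ Q x) (k + j)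
HasSize-⊎ P⇒¬Q (xs , u , refl , sound , complete) (ys , v , refl , sound′ , complete′) =
  xs ++ ys ,
  ++⁺ u v (λ (x∈xs , x∈ys) → P⇒¬Q (sound _ x∈xs) (sound′ _ x∈ys)) ,
  length-++ xs ,
  (λ x x∈ → Sum.map (sound x) (sound′ x) (∈-++⁻ xs x∈)) ,
  (λ x → [ (λ px → ∈-++⁺ˡ (complete x px)) , (λ qx → ∈-++⁺ʳ xs (complete′ x qx)) ])

HasSize-× : {R : A → B → Set} {m : ℕ} → (∀ {x} → P x → HasSize (R x) m) → HasSize P k →
            HasSize (λ (x , y) → P x × R x y) (k * m)
HasSize-× {A = A} {B = B} {R = R} {m = m} hasSize-R (xs , u , refl , sound , complete) =
  HasSize-⇔ (map₁ (sound _)) (map₁ (complete _)) (over xs u (hasSize-R ∘ sound _))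
  where
  Over : List A → A × B → Set
  Over xs (x , y) = x ∈ xs × R x y

  over : (xs : List A) → Unique xs → (∀ {x} → x ∈ xs → HasSize (R x) m) →
         HasSize (Over xs) (length xs * m)
  over [] _ _ = [] , [] , refl , (λ _ ()) , (λ { (_ , _) (() , _) })
  over (x ∷ xs) (x∉xs ∷ u) hasSize-R =
    HasSize-⇔ merge split (HasSize-⊎ disjoint fibre (over xs u (hasSize-R ∘ there)))
    where
    Fibre : A × B → Set
    Fibre (x′ , y) = x′ ≡ x × R x′ y

    fibre : HasSize Fibre m
    fibre = HasSize-map (x ,_) (λ { refl → refl }) (refl ,_) (λ { {_ , _} (refl , r) → _ , r , refl })
                        (hasSize-R (here refl))

    disjoint : ∀ {z} → Fibre z → ¬ Over xs z
    disjoint {_ , _} (refl , _) (x∈xs , _) = All.lookup x∉xs x∈xs refl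

    merge : ∀ {z} → Fibre z ⊎ Over xs z → Over (x ∷ xs) z
    merge {_ , _} (inj₁ (refl , r)) = here refl , r
    merge {_ , _} (inj₂ (x∈xs , r)) = there x∈xs , r

    split : ∀ {z} → Over (x ∷ xs) z → Fibre z ⊎ Over xs z
    split {_ , _} (here refl , r) = inj₁ (refl , r)
    split {_ , _} (there x∈xs , r) = inj₂ (x∈xs , r)

HasSize-∩ : Decidable Q → HasSize P k → ∃[ m ] HasSize (λ x → P x × Q x) m
HasSize-∩ Q? (xs , u , _ , sound , complete) =
  _ , filter Q? xs , filter⁺ Q? u , refl ,
  (λ x x∈ → map₁ (sound x) (∈-filter⁻ Q? x∈)) ,
  (λ x (px , qx) → ∈-filter⁺ Q? (complete x px) qx)

HasSize-∖ : Decidable Q → (∀ {x} → Q x → P x) → HasSize P k → HasSize Q j →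
            HasSize (λ x → P x × ¬ Q x) (k ∸ j)
HasSize-∖ {k = k} {j = j} Q? Q⇒P hasSize-P hasSize-Q
  with m , hasSize-P∖Q ← HasSize-∩ (∁? Q?) hasSize-P =
  subst (HasSize _) (trans (sym (m+n∸m≡n j m)) (cong (_∸ j) j+m≡k)) hasSize-P∖Q
  where
  j+m≡k : j + m ≡ k
  j+m≡k = HasSize-unique (HasSize-⇔ [ Q⇒P , proj₁ ] (λ px → Sum.map₂ (px ,_) (toSum (Q? _)))
                                     (HasSize-⊎ (λ qx (_ , ¬qx) → ¬qx qx) hasSize-Q hasSize-P∖Q))
                         hasSize-P

HasSize-Fin : (n : ℕ) → HasSize {Fin n} (λ _ → ⊤) n
HasSize-Fin n = allFin n , allFin⁺ n , length-tabulate id , (λ _ _ → tt) , (λ x _ → ∈-allFin x)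

HasSize-≡ : (a : A) → HasSize (_≡ a) 1
HasSize-≡ a = a ∷ [] , [] ∷ [] , refl , (λ { _ (here refl) → refl }) , (λ { _ refl → here refl })

HasSize-words : HasSize P k → (c : ℕ) → HasSize (λ w → length w ≡ c × All P w) (k ^ c)
HasSize-words _ zero =
  [] ∷ [] , [] ∷ [] , refl ,
  (λ { _ (here refl) → refl , [] }) ,
  (λ { [] _ → here refl ; (_ ∷ _) (() , _) })
HasSize-words {P = P} hasSize-P (suc c) =
  HasSize-map (uncurry _∷_) (λ { refl → refl }) (λ (px , l , pw) → cong suc l , px ∷ pw) decompose
              (HasSize-× (λ _ → HasSize-words hasSize-P c) hasSize-P)
  where
  decompose : ∀ {w} → length w ≡ suc c × All P w →
              ∃[ (x , u) ] (P x × length u ≡ c × All P u) × x ∷ u ≡ w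
  decompose {x ∷ u} (refl , px ∷ pu) = (x , u) , (px , refl , pu) , refl

data ExitsAt (P : A → Set) : List A → ℕ → Set where
  here  : ∀ {x s} → ¬ P x → ExitsAt P (x ∷ s) 0
  there : ∀ {x s p} → P x → ExitsAt P s p → ExitsAt P (x ∷ s) (suc p)

ExitsAt-unique : ∀ {s p q} → ExitsAt P s p → ExitsAt P s q → p ≡ q
ExitsAt-unique (here _) (here _) = refl
ExitsAt-unique (here ¬px) (there px _) = ⊥-elim (¬px px)
ExitsAt-unique (there px _) (here ¬px) = ⊥-elim (¬px px)
ExitsAt-unique (there _ e) (there _ e′) = cong suc (ExitsAt-unique e e′)

ExitsAt-++ : ∀ {u p} v → ExitsAt P u p → ExitsAt P (u ++ v) p
ExitsAt-++ v (here ¬px) = here ¬px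
ExitsAt-++ v (there px e) = there px (ExitsAt-++ v e)

¬All⇒ExitsAt : Decidable P → ∀ s → ¬ All P s → ∃[ p ] ExitsAt P s p
¬All⇒ExitsAt P? [] ¬all = ⊥-elim (¬all [])
¬All⇒ExitsAt P? (x ∷ s) ¬all with P? x
... | no ¬px = 0 , here ¬px
... | yes px with p , e ← ¬All⇒ExitsAt P? s (¬all ∘ (px ∷_)) = suc p , there px e

OneOf : Fin n → Fin n → Fin n → Set
OneOf a b x = x ≡ a ⊎ x ≡ b

oneOf? : (a b : Fin n) → Decidable (OneOf a b)
oneOf? a b x = x Fin.≟ a ⊎-dec x Fin.≟ b

triple : Fin n → Fin n → Word n → WordSeq n 3
triple a b w = (a ∷ []) ∷ (b ∷ []) ∷ w ∷ []

module _ {a b : Fin n} {w : Word n} {p : ℕ} (w-exits : ExitsAt (OneOf a b) w p) where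

  private
    T : WordSeq n 3
    T = triple a b w

  factor-exits-late : ∀ is {q} → ExitsAt (OneOf a b) (factor T is) q → p ≤ q
  factor-exits-late (zero ∷ is) (here a∉ab) = ⊥-elim (a∉ab (inj₁ refl))
  factor-exits-late (zero ∷ is) (there _ e) = m≤n⇒m≤1+n (factor-exits-late is e)
  factor-exits-late (suc zero ∷ is) (here b∉ab) = ⊥-elim (b∉ab (inj₂ refl))
  factor-exits-late (suc zero ∷ is) (there _ e) = m≤n⇒m≤1+n (factor-exits-late is e)
  factor-exits-late (suc (suc zero) ∷ is) e =
    ≤-reflexive (ExitsAt-unique (ExitsAt-++ (factor T is) w-exits) e)

  letter∷factor≢w++factor : ∀ {x} → OneOf a b x → ∀ is js → x ∷ factor T is ≢ w ++ factor T js
  letter∷factor≢w++factor x∈ab is js e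
    with subst (λ s → ExitsAt _ s p) (sym e) (ExitsAt-++ (factor T js) w-exits)
  ... | here x∉ab = x∉ab x∈ab
  ... | there _ e′ = 1+n≰n (factor-exits-late is e′)

  factor-∷≢[] : ∀ i is → factor T (i ∷ is) ≢ []
  factor-∷≢[] zero _ ()
  factor-∷≢[] (suc zero) _ ()
  factor-∷≢[] (suc (suc zero)) is e
    with subst (λ s → ExitsAt _ s p) e (ExitsAt-++ (factor T is) w-exits)
  ... | ()

  module _ (a≢b : a ≢ b) where

    factor-head-injective : ∀ i j is js → factor T (i ∷ is) ≡ factor T (j ∷ js) → i ≡ j
    factor-head-injective zero zero _ _ _ = refl
    factor-head-injective (suc zero) (suc zero) _ _ _ = refl
    factor-head-injective (suc (suc zero)) (suc (suc zero)) _ _ _ = refl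
    factor-head-injective zero (suc zero) _ _ e = ⊥-elim (a≢b (∷-injectiveˡ e))
    factor-head-injective (suc zero) zero _ _ e = ⊥-elim (a≢b (sym (∷-injectiveˡ e)))
    factor-head-injective zero (suc (suc zero)) is js e = ⊥-elim (letter∷factor≢w++factor (inj₁ refl) is js e)
    factor-head-injective (suc zero) (suc (suc zero)) is js e = ⊥-elim (letter∷factor≢w++factor (inj₂ refl) is js e)
    factor-head-injective (suc (suc zero)) zero is js e = ⊥-elim (letter∷factor≢w++factor (inj₁ refl) js is (sym e))
    factor-head-injective (suc (suc zero)) (suc zero) is js e = ⊥-elim (letter∷factor≢w++factor (inj₂ refl) js is (sym e))

    factor-injective : ∀ is js → factor T is ≡ factor T js → is ≡ js
    factor-injective [] [] _ = refl
    factor-injective [] (j ∷ js) e = ⊥-elim (factor-∷≢[] j js (sym e))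
    factor-injective (i ∷ is) [] e = ⊥-elim (factor-∷≢[] i is e)
    factor-injective (i ∷ is) (j ∷ js) e with refl ← factor-head-injective i j is js e =
      cong (i ∷_) (factor-injective is js (++-cancelˡ (lookup T i) _ _ e))

triple-isCode : ∀ {a b : Fin n} {w} → a ≢ b → ¬ All (OneOf a b) w → IsCode (triple a b w)
triple-isCode {a = a} {b} {w} a≢b ¬over is js _ _ =
  factor-injective (proj₂ (¬All⇒ExitsAt (oneOf? a b) w ¬over)) a≢b is js

isCode-triple⇒≢ : ∀ {a b : Fin n} {w} → IsCode (triple a b w) → a ≢ b
isCode-triple⇒≢ code refl with () ← code (zero ∷ []) (suc zero ∷ []) (λ ()) (λ ()) refl

module _ {a b : Fin n} where

  letterIndex : ∀ {x} → OneOf a b x → Fin 3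
  letterIndex (inj₁ _) = zero
  letterIndex (inj₂ _) = suc zero

  spell : ∀ {w} → All (OneOf a b) w → List (Fin 3)
  spell [] = []
  spell (x∈ab ∷ w∈ab) = letterIndex x∈ab ∷ spell w∈ab

  factor-spell : ∀ {v w} (w∈ab : All (OneOf a b) w) → factor (triple a b v) (spell w∈ab) ≡ w
  factor-spell [] = refl
  factor-spell (inj₁ refl ∷ w∈ab) = cong (a ∷_) (factor-spell w∈ab)
  factor-spell (inj₂ refl ∷ w∈ab) = cong (b ∷_) (factor-spell w∈ab)

  isCode-triple⇒¬over : ∀ {w} → 1 ≤ length w → IsCode (triple a b w) → ¬ All (OneOf a b) w
  isCode-triple⇒¬over () _ []
  isCode-triple⇒¬over {w} _ code (x∈ab ∷ w∈ab) = letterIndex≢2 x∈ab (∷-injectiveˡ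
    (code (suc (suc zero) ∷ []) (spell (x∈ab ∷ w∈ab)) (λ ()) (λ ())
          (trans (++-identityʳ w) (sym (factor-spell (x∈ab ∷ w∈ab))))))
    where
    letterIndex≢2 : ∀ {x} (x∈ab : OneOf a b x) → suc (suc zero) ≢ letterIndex x∈ab
    letterIndex≢2 (inj₁ _) ()
    letterIndex≢2 (inj₂ _) ()

CodeTriple : ℕ → (Fin n × Fin n) × Word n → Set
CodeTriple {n} c ((a , b) , w) = a ≢ b × length w ≡ c × ¬ All (OneOf a b) w

UD-triple : ∀ {x} → CodeTriple c x → UD n (1 ∷ 1 ∷ c ∷ []) (uncurry (uncurry triple) x)
UD-triple (a≢b , |w|≡c , ¬over) = (refl ∷ refl ∷ |w|≡c ∷ []) , triple-isCode a≢b ¬over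

UD⇒triple : 1 ≤ c → ∀ {C} → UD n (1 ∷ 1 ∷ c ∷ []) C →
            ∃[ x ] CodeTriple c x × uncurry (uncurry triple) x ≡ C
UD⇒triple 1≤c {(a ∷ []) ∷ (b ∷ []) ∷ w ∷ []} ((refl ∷ refl ∷ refl ∷ []) , code) =
  ((a , b) , w) , (isCode-triple⇒≢ code , refl , isCode-triple⇒¬over 1≤c code) , refl

HasSize-≢ : (a : Fin n) → HasSize (_≢ a) (n ∸ 1)
HasSize-≢ {n} a =
  HasSize-⇔ proj₂ (tt ,_) (HasSize-∖ (Fin._≟ a) (λ _ → tt) (HasSize-Fin n) (HasSize-≡ a))

HasSize-distinctPairs : HasSize {Fin n × Fin n} (λ (a , b) → a ≢ b) (n * (n ∸ 1))
HasSize-distinctPairs {n} =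
  HasSize-⇔ (λ (_ , b≢a) → b≢a ∘ sym) (λ a≢b → tt , a≢b ∘ sym)
            (HasSize-× (λ {a} _ → HasSize-≢ a) (HasSize-Fin n))

HasSize-oneOf : {a b : Fin n} → a ≢ b → HasSize (OneOf a b) 2
HasSize-oneOf {a = a} {b} a≢b =
  HasSize-⊎ (λ x≡a x≡b → a≢b (trans (sym x≡a) x≡b)) (HasSize-≡ a) (HasSize-≡ b)

HasSize-wordsNotOver : {a b : Fin n} → a ≢ b → (c : ℕ) →
                       HasSize (λ w → length w ≡ c × ¬ All (OneOf a b) w) (n ^ c ∸ 2 ^ c)
HasSize-wordsNotOver {n} {a} {b} a≢b c =
  HasSize-⇔ (λ ((|w|≡c , _) , ¬over) → |w|≡c , λ over → ¬over (|w|≡c , over))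
            (λ (|w|≡c , ¬over) → (|w|≡c , All.universal (λ _ → tt) _) , ¬over ∘ proj₂)
            (HasSize-∖ (λ w → length w ≟ c ×-dec all? (oneOf? a b) w)
                       (λ (|w|≡c , _) → |w|≡c , All.universal (λ _ → tt) _)
                       (HasSize-words (HasSize-Fin n) c) (HasSize-words (HasSize-oneOf a≢b) c))

proposition2 : (n c : ℕ) → 2 ≤ n → 1 ≤ c →
    HasSize (UD n (1 ∷ 1 ∷ c ∷ [])) (n * (n ∸ 1) * (n ^ c ∸ 2 ^ c))
proposition2 n c _ 1≤c =
  HasSize-map (uncurry (uncurry triple)) (λ { refl → refl }) UD-triple (UD⇒triple 1≤c)
              (HasSize-× (λ a≢b → HasSize-wordsNotOver a≢b c) HasSize-distinctPairs)
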